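{- Let $e,p \in \mathbb{Z}^+$ and suppose $U_{e,!}$ is absolute and $(e,p)$-nice. Then there exist arbitrarily long sequences of consecutive integers which iterate to $p$ after repeated application of $S_{e,!}$.
   Context: Every positive integer $n$ has a unique factoradic (factorial base) representation $n=\sum_{i=1}^k a_i\cdot i!$ with $a_k\neq 0$ and $0\leq a_i\leq i$ for $1\leq i\leq k$. For an integer $e\geq 1$, the $e$-power factoradic happy function $S_{e,!}:\mathbb{Z}_{\geq 0}\to\mathbb{Z}_{\geq 0}$ is defined by $S_{e,!}(0)=0$ and $S_{e,!}(n)=\sum_{i=1}^k a_i^e$ for $n\geq 1$; $S_{e,!}^\ell$ denotes the $\ell$-th iterate, with $S_{e,!}^0(n)=n$. $U_{e,!}$ is the set of all positive integers $n$ for which there exists $\ell\geq 1$ with $S_{e,!}^\ell(n)=n$ (fixed points and cycle elements). $U_{e,!}$ is called absolute if for every $n\in\mathbb{Z}^+$ there exists a nonnegative integer $r_n$ such that $S_{e,!}^r(n)\in U_{e,!}$ for all integers $r\geq r_n$. For $e,p\in\mathbb{Z}^+$, a set $D$ is called $(e,p)$-nice if there exists an integer $l\geq 0$ such that for every $d\in D$ there is an integer $q_d\geq 0$ with $S_{e,!}^{q_d}(l+d)=p$. -}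

module Defs where

open import Data.Nat using (ℕ; zero; suc; _+_; _^_; _≤_; _<_)
open import Data.Nat.DivMod using (_/_; _%_)
open import Data.List using (List; []; _∷_; map)
open import Data.Nat.ListAction using (sum)
open import Data.Product using (Σ; ∃; ∃-syntax; _×_)
open import Relation.Binary.PropositionalEquality using (_≡_)

-- Factoradic digits of n, least significant first:
-- factDigitsAux fuel i n  returns [a_i, a_{i+1}, ...] where n is the
-- remaining quotient at position i (divide successively by 2, 3, 4, ...).
-- Fuel n suffices since the quotient at least halves at every step.
factDigitsAux : ℕ → ℕ → ℕ → List ℕ
factDigitsAux zero    i n       = []
factDigitsAux (suc f) i zero    = []
factDigitsAux (suc f) i (suc m) =
  (suc m % suc i) ∷ factDigitsAux f (suc i) (suc m / suc i)

-- factDigits n = [a_1, a_2, ..., a_k] with n = Σ a_i · i!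
factDigits : ℕ → List ℕ
factDigits n = factDigitsAux n 1 n

S : ℕ → ℕ → ℕ
S e n = sum (map (λ a → a ^ e) (factDigits n))

iter : ℕ → (ℕ → ℕ) → ℕ → ℕ
iter zero    f n = n
iter (suc l) f n = f (iter l f n)

InU : ℕ → ℕ → Set
InU e n = (1 ≤ n) × ∃[ l ] ((1 ≤ l) × (iter l (S e) n ≡ n))

Absolute : ℕ → Set
Absolute e = ∀ n → 1 ≤ n → ∃[ rₙ ] (∀ r → rₙ ≤ r → InU e (iter r (S e) n))

Nice : ℕ → ℕ → (ℕ → Set) → Set
Nice e p D = ∃[ l ] (∀ d → D d → ∃[ q ] (iter q (S e) (l + d) ≡ p))

-- Put a block of factoradic digits y below place (k+1)! and t digits 1 above it: then
-- S (N + y) = t + S y with N = (k+1)! · 11…1.  Pushing such translations through the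
-- finitely many values S^j y gives, for a finite set Y and any r, t, one N with
-- S^r (N + y) = t + S^r y for all y ∈ Y.  For Y = {1, …, m} and r so large that all
-- S^r y lie in U (absoluteness), niceness provides t = l with l + S^r y iterating to p.
{-# OPTIONS --safe #-}
module Submission where

open import Defs
open import Data.Nat using (ℕ; zero; suc; _+_; _*_; _^_; _≤_; _<_; _⊔_; z≤n; s≤s)
open import Data.Nat.Properties
open import Data.Nat.DivMod
open import Data.Nat.Divisibility using (n∣m*n)
open import Data.Nat.ListAction using (sum)
open import Data.Nat.Tactic.RingSolver using (solve-∀)
open import Data.List using (List; _∷_; map; applyUpTo)
open import Data.List.Extrema.Nat using (max; xs≤max)
open import Data.List.Membership.Propositional using (_∈_)
open import Data.List.Membership.Propositional.Properties using (∈-map⁺; ∈-applyUpTo⁺)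
open import Data.List.Relation.Unary.All using (lookup)
open import Data.Product using (∃; ∃-syntax; _,_)
open import Data.Sum using (inj₁; inj₂)
open import Relation.Binary.PropositionalEquality

[1+m]/[1+n]≤m : ∀ m n → 1 ≤ n → suc m / suc n ≤ m
[1+m]/[1+n]≤m m n 1≤n = ≤-pred (m/n<m (suc m) (suc n) (s≤s 1≤n))

factDigitsAux-fuel : ∀ f f′ i n → 1 ≤ i → n ≤ f → n ≤ f′ →
  factDigitsAux f i n ≡ factDigitsAux f′ i n
factDigitsAux-fuel zero    zero     i n       _   _         _          = refl
factDigitsAux-fuel zero    (suc f′) i zero    _   _         _          = refl
factDigitsAux-fuel (suc f) zero     i zero    _   _         _          = refl
factDigitsAux-fuel (suc f) (suc f′) i zero    _   _         _          = refl
factDigitsAux-fuel (suc f) (suc f′) i (suc m) 1≤i (s≤s m≤f) (s≤s m≤f′) =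
  cong (suc m % suc i ∷_)
    (factDigitsAux-fuel f f′ (suc i) (suc m / suc i) (s≤s z≤n)
      (≤-trans q≤m m≤f) (≤-trans q≤m m≤f′))
  where q≤m = [1+m]/[1+n]≤m m i 1≤i

-- Sfrom e i n reads n in the mixed radix with place values (i+1)(i+2)⋯j, i.e. as the
-- factoradic digits from place i on; S e n is Sfrom e 1 n.
Sfrom : ℕ → ℕ → ℕ → ℕ
Sfrom e i n = sum (map (_^ e) (factDigitsAux n i n))

-- The exponent must be positive: for n = 0 the right side has the summand 0 ^ e.
Sfrom-unfold : ∀ e i n → 1 ≤ i →
  Sfrom (suc e) i n ≡ (n % suc i) ^ suc e + Sfrom (suc e) (suc i) (n / suc i)
Sfrom-unfold e i zero    _   = refl
Sfrom-unfold e i (suc m) 1≤i =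
  cong (λ ds → (suc m % suc i) ^ suc e + sum (map (_^ suc e) ds))
    (factDigitsAux-fuel m q (suc i) q (s≤s z≤n) ([1+m]/[1+n]≤m m i 1≤i) ≤-refl)
  where q = suc m / suc i

Sfrom-digit : ∀ e i a q → 1 ≤ i → a < suc i →
  Sfrom (suc e) i (a + suc i * q) ≡ a ^ suc e + Sfrom (suc e) (suc i) q
Sfrom-digit e i a q 1≤i a<1+i = begin
  Sfrom (suc e) i n
    ≡⟨ Sfrom-unfold e i n 1≤i ⟩
  (n % suc i) ^ suc e + Sfrom (suc e) (suc i) (n / suc i)
    ≡⟨ cong₂ (λ d n′ → d ^ suc e + Sfrom (suc e) (suc i) n′) n%[1+i] n/[1+i] ⟩
  a ^ suc e + Sfrom (suc e) (suc i) q
    ∎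
  where
  open ≡-Reasoning
  n = a + suc i * q
  n≡a+q*[1+i] : n ≡ a + q * suc i
  n≡a+q*[1+i] = cong (a +_) (*-comm (suc i) q)
  n%[1+i] : n % suc i ≡ a
  n%[1+i] = begin
    n % suc i               ≡⟨ cong (_% suc i) n≡a+q*[1+i] ⟩
    (a + q * suc i) % suc i ≡⟨ [m+kn]%n≡m%n a q (suc i) ⟩
    a % suc i               ≡⟨ m<n⇒m%n≡m a<1+i ⟩
    a                       ∎
  n/[1+i] : n / suc i ≡ q
  n/[1+i] = begin
    n / suc i                       ≡⟨ cong (_/ suc i) n≡a+q*[1+i] ⟩
    (a + q * suc i) / suc i         ≡⟨ +-distrib-/-∣ʳ a (n∣m*n q) ⟩
    a / suc i + q * suc i / suc i   ≡⟨ cong₂ _+_ (m<n⇒m/n≡0 a<1+i) (m*n/n≡m q (suc i)) ⟩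
    q                               ∎

-- rising i k = (i+1)(i+2)⋯(i+k) = (i+k)! / i!: the place value of place i+k relative to place i.
rising : ℕ → ℕ → ℕ
rising i zero    = 1
rising i (suc k) = suc i * rising (suc i) k

k<rising : ∀ i k → 1 ≤ i → k < rising i k
k<rising i zero    _   = s≤s z≤n
k<rising i (suc k) 1≤i = begin-strict
  suc k
    <⟨ ≤-reflexive (+-comm 1 (suc k)) ⟩
  suc k + 1
    ≤⟨ +-mono-≤ k<R (*-mono-≤ 1≤i (≤-trans (s≤s z≤n) k<R)) ⟩
  rising (suc i) k + i * rising (suc i) k
    ∎
  where
  open ≤-Reasoning
  k<R = k<rising (suc i) k (s≤s z≤n)

digit-regroup : ∀ a q n R b → a + q * n + n * R * b ≡ a + n * (q + R * b)
digit-regroup = solve-∀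

Sfrom-concat : ∀ e i k y b → 1 ≤ i → y < rising i k →
  Sfrom (suc e) i (y + rising i k * b) ≡ Sfrom (suc e) i y + Sfrom (suc e) (i + k) b
Sfrom-concat e i zero    zero    b _ _ =
  cong₂ (Sfrom (suc e)) (sym (+-identityʳ i)) (+-identityʳ b)
Sfrom-concat e i zero    (suc y) b _ (s≤s ())
Sfrom-concat e i (suc k) y       b 1≤i y<R = begin
  Sfrom (suc e) i (y + suc i * R′ * b)
    ≡⟨ cong (Sfrom (suc e) i) regroup ⟩
  Sfrom (suc e) i (a + suc i * (q + R′ * b))
    ≡⟨ Sfrom-digit e i a _ 1≤i (m%n<n y (suc i)) ⟩
  a ^ suc e + Sfrom (suc e) (suc i) (q + R′ * b)
    ≡⟨ cong (a ^ suc e +_) (Sfrom-concat e (suc i) k q b (s≤s z≤n) q<R′) ⟩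
  a ^ suc e + (Sfrom (suc e) (suc i) q + Sfrom (suc e) (suc i + k) b)
    ≡⟨ +-assoc (a ^ suc e) _ _ ⟨
  (a ^ suc e + Sfrom (suc e) (suc i) q) + Sfrom (suc e) (suc i + k) b
    ≡⟨ cong₂ _+_ (Sfrom-unfold e i y 1≤i) (cong (λ j → Sfrom (suc e) j b) (+-suc i k)) ⟨
  Sfrom (suc e) i y + Sfrom (suc e) (i + suc k) b
    ∎
  where
  open ≡-Reasoning
  R′ = rising (suc i) k
  a = y % suc i
  q = y / suc i
  q<R′ : q < R′
  q<R′ = m<n*o⇒m/o<n (subst (y <_) (*-comm (suc i) R′) y<R)
  regroup : y + suc i * R′ * b ≡ a + suc i * (q + R′ * b)
  regroup = trans (cong (_+ suc i * R′ * b) (m≡m%n+[m/n]*n y (suc i)))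
                  (digit-regroup a q (suc i) R′ b)

ones : ℕ → ℕ → ℕ
ones j zero    = 0
ones j (suc t) = 1 + suc j * ones (suc j) t

Sfrom-ones : ∀ e j t → 1 ≤ j → Sfrom (suc e) j (ones j t) ≡ t
Sfrom-ones e j zero    _   = refl
Sfrom-ones e j (suc t) 1≤j = begin
  Sfrom (suc e) j (1 + suc j * ones (suc j) t)
    ≡⟨ Sfrom-digit e j 1 _ 1≤j (s≤s 1≤j) ⟩
  1 ^ suc e + Sfrom (suc e) (suc j) (ones (suc j) t)
    ≡⟨ cong₂ _+_ (^-zeroˡ (suc e)) (Sfrom-ones e (suc j) t (s≤s z≤n)) ⟩
  suc t
    ∎
  where open ≡-Reasoning

S-shift : ∀ e k t y → y < rising 1 k →
  S (suc e) (rising 1 k * ones (suc k) t + y) ≡ t + S (suc e) y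
S-shift e k t y y<R = begin
  Sfrom (suc e) 1 (rising 1 k * ones (suc k) t + y)
    ≡⟨ cong (Sfrom (suc e) 1) (+-comm _ y) ⟩
  Sfrom (suc e) 1 (y + rising 1 k * ones (suc k) t)
    ≡⟨ Sfrom-concat e 1 k y _ ≤-refl y<R ⟩
  Sfrom (suc e) 1 y + Sfrom (suc e) (suc k) (ones (suc k) t)
    ≡⟨ cong (Sfrom (suc e) 1 y +_) (Sfrom-ones e (suc k) t (s≤s z≤n)) ⟩
  Sfrom (suc e) 1 y + t
    ≡⟨ +-comm _ t ⟩
  t + Sfrom (suc e) 1 y
    ∎
  where open ≡-Reasoning

iter-suc : ∀ r (f : ℕ → ℕ) x → iter (suc r) f x ≡ iter r f (f x)
iter-suc zero    f x = refl
iter-suc (suc r) f x = cong f (iter-suc r f x)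

iter-+ : ∀ q r (f : ℕ → ℕ) x → iter (q + r) f x ≡ iter q f (iter r f x)
iter-+ zero    r f x = refl
iter-+ (suc q) r f x = cong f (iter-+ q r f x)

translation-through-iter : ∀ e r (ys : List ℕ) t → ∃[ N ] (∀ {y} → y ∈ ys →
  iter r (S (suc e)) (N + y) ≡ t + iter r (S (suc e)) y)
translation-through-iter e zero    ys t = t , λ _ → refl
translation-through-iter e (suc r) ys t
  with N′ , shift′ ← translation-through-iter e r (map (S (suc e)) ys) t =
  rising 1 k * ones (suc k) N′ , shift
  where
  open ≡-Reasoning
  f = S (suc e)
  k = max 0 ys
  shift : ∀ {y} → y ∈ ys →
    iter (suc r) f (rising 1 k * ones (suc k) N′ + y) ≡ t + iter (suc r) f y
  shift {y} y∈ys = begin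
    iter (suc r) f (rising 1 k * ones (suc k) N′ + y) ≡⟨ iter-suc r f _ ⟩
    iter r f (f (rising 1 k * ones (suc k) N′ + y))   ≡⟨ cong (iter r f) (S-shift e k N′ y y<R) ⟩
    iter r f (N′ + f y)                               ≡⟨ shift′ (∈-map⁺ f y∈ys) ⟩
    t + iter r f (f y)                                ≡⟨ cong (t +_) (iter-suc r f y) ⟨
    t + iter (suc r) f y                              ∎
    where y<R = ≤-<-trans (lookup (xs≤max 0 ys) y∈ys) (k<rising 1 k ≤-refl)

Absolute⇒uniform : ∀ e → Absolute e → ∀ m →
  ∃[ R ] (∀ {i} → i < m → ∀ r → R ≤ r → InU e (iter r (S e) (suc i)))
Absolute⇒uniform e absolute zero = 0 , λ ()
Absolute⇒uniform e absolute (suc m)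
  with R , inU ← Absolute⇒uniform e absolute m
     | Rₘ , inUₘ ← absolute (suc m) (s≤s z≤n) = R ⊔ Rₘ , inU′
  where
  inU′ : ∀ {i} → i < suc m → ∀ r → R ⊔ Rₘ ≤ r → InU e (iter r (S e) (suc i))
  inU′ (s≤s i≤m) r R⊔Rₘ≤r with m≤n⇒m<n∨m≡n i≤m
  ... | inj₁ i<m  = inU i<m r (≤-trans (m≤m⊔n R Rₘ) R⊔Rₘ≤r)
  ... | inj₂ refl = inUₘ r (≤-trans (m≤n⊔m R Rₘ) R⊔Rₘ≤r)

theorem1p3 : (e p : ℕ) → 1 ≤ e → 1 ≤ p → Absolute e → Nice e p (InU e) →
    (m : ℕ) → ∃[ N ] (∀ i → i < m → ∃[ q ] (iter q (S e) (N + i) ≡ p))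
theorem1p3 (suc e) p _ _ absolute (l , nice) m
  with Absolute⇒uniform (suc e) absolute m
... | R , inU with translation-through-iter e R (applyUpTo suc m) l
... | N , shift = suc N , reaches-p
  where
  f = S (suc e)
  reaches-p : ∀ i → i < m → ∃[ q ] (iter q f (suc N + i) ≡ p)
  reaches-p i i<m with q , reach ← nice _ (inU i<m R ≤-refl) = q + R , (begin
    iter (q + R) f (suc N + i)          ≡⟨ cong (iter (q + R) f) (+-suc N i) ⟨
    iter (q + R) f (N + suc i)          ≡⟨ iter-+ q R f _ ⟩
    iter q f (iter R f (N + suc i))     ≡⟨ cong (iter q f) (shift (∈-applyUpTo⁺ suc i<m)) ⟩
    iter q f (l + iter R f (suc i))     ≡⟨ reach ⟩
    p                                   ∎)
    where open ≡-Reasoning
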